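{- Let $X$ be a finite simple graph and let $T$ be its modular tree. For any two distinct vertices $x,y\in V(X)$ we have $xy\in E(X)$ if and only if there exists a path $x\,m_1\,m_2\dots m_k\,y$ in $T$ (with $k\ge 0$) such that every $m_i$ is a marker vertex and the tree edges of this path are precisely the edges $m_{2i-1}m_{2i}$ (all other edges of the path, including $xm_1$ and $m_ky$, being normal edges; tree edges are traversed regardless of their direction).
   Context: A module of a graph $X$ is a set $M\subseteq V(X)$ such that every $x\in V(X)\setminus M$ is adjacent either to all vertices of $M$ or to none. It is trivial if $M=V(X)$ or $|M|=1$. A graph is prime if all its modules are trivial, and degenerate if it is $K_n$ or $\overline{K_n}$. For a modular partition $\mathcal P=\{M_1,\dots,M_k\}$ of $V(X)$ (a partition into modules), the quotient $X/\mathcal P$ has vertices $m_1,\dots,m_k$ with $m_im_j$ an edge iff $M_i$ and $M_j$ are adjacent (all edges between them present). The modular decomposition: if $X$ is prime or degenerate, stop; if $X$ and $\overline X$ are connected, use the partition $\mathcal P$ into inclusion-maximal proper modules (then $X/\mathcal P$ is prime); if $X$ is disconnected and $\overline X$ connected, use the partition into connected components of $X$; if $\overline X$ is disconnected and $X$ connected, use the partition into connected components of $\overline X$; then recurse on each $X[M_i]$. The modular tree $T$ of $X$ is defined recursively; it has normal and marker vertices, normal edges and directed tree edges, and a designated root node. If $X$ is prime or degenerate, $T=X$ (all vertices and edges normal) and the root node is $T$. Otherwise, with $\mathcal P=\{M_1,\dots,M_k\}$ the partition used above and $T_1,\dots,T_k$ the modular trees of $X[M_1],\dots,X[M_k]$,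 $T$ is the disjoint union of $T_1,\dots,T_k$ and of the quotient $X/\mathcal P$ (the root node of $T$) whose vertices $m_1,\dots,m_k$ are marker vertices; for each $i$ a new marker vertex $m_i'$ is added, joined by normal edges exactly to the vertices of the root node of $T_i$, and a tree edge directed from $m_i$ to $m_i'$ is added. The vertices of $X$ are the normal vertices of $T$. -}

module Defs where

open import Data.Nat using (ℕ)
open import Data.Fin using (Fin; _≟_)
open import Data.Bool using (Bool; true; false; not; _∧_; if_then_else_)
open import Data.Product using (Σ; ∃; ∃-syntax; _×_; _,_)
open import Data.Sum using (_⊎_; inj₁; inj₂)
open import Data.Maybe using (Maybe; just; nothing)
open import Data.Empty using (⊥; ⊥-elim)
open import Data.Unit using (⊤)
open import Data.List using (List; []; _∷_; _++_; [_])
open import Data.List.Relation.Unary.All using (All)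
open import Data.List.Relation.Unary.Unique.Propositional using (Unique)
open import Relation.Nullary using (¬_; yes; no; does)
open import Relation.Binary.PropositionalEquality using (_≡_; _≢_; refl; sym; cong)

record Graph (n : ℕ) : Set where
  field
    adj        : Fin n → Fin n → Bool
    adj-sym    : ∀ u v → adj u v ≡ adj v u
    adj-irrefl : ∀ u → adj u u ≡ false

open Graph public

Adj : ∀ {n} → Graph n → Fin n → Fin n → Set
Adj G u v = adj G u v ≡ true

compl : ∀ {n} → Graph n → Graph n
compl {n} G = record { adj = a ; adj-sym = s ; adj-irrefl = i }
  where
  a : Fin n → Fin n → Bool
  a u v = if does (u ≟ v) then false else not (adj G u v)
  s : ∀ u v → a u v ≡ a v u
  s u v with u ≟ v | v ≟ u
  ... | yes _ | yes _ = refl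
  ... | yes p | no q = ⊥-elim (q (sym p))
  ... | no p | yes q = ⊥-elim (p (sym q))
  ... | no _ | no _ = cong not (adj-sym G u v)
  i : ∀ u → a u u ≡ false
  i u with u ≟ u
  ... | yes _ = refl
  ... | no ne = ⊥-elim (ne refl)

-- Vertex subsets (a subset S stands for the induced subgraph X[S])

VSet : ℕ → Set
VSet n = Fin n → Bool

full : ∀ {n} → VSet n
full _ = true

infix 4 _∈_ _⊆_ _≐_
_∈_ : ∀ {n} → Fin n → VSet n → Set
v ∈ S = S v ≡ true

_⊆_ : ∀ {n} → VSet n → VSet n → Set
M ⊆ S = ∀ v → v ∈ M → v ∈ S

_≐_ : ∀ {n} → VSet n → VSet n → Set
M ≐ S = ∀ v → M v ≡ S v

-- the i-th block of the partition of S given by the labelling f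
part : ∀ {n k} → VSet n → (Fin n → Fin k) → Fin k → VSet n
part S f i v = S v ∧ does (f v ≟ i)

in-own-part : ∀ {n k} (S : VSet n) (f : Fin n → Fin k) v → v ∈ S → v ∈ part S f (f v)
in-own-part S f v h rewrite h with f v ≟ f v
... | yes _ = refl
... | no ne = ⊥-elim (ne refl)

data Reach {n} (G : Graph n) (S : VSet n) : Fin n → Fin n → Set where
  here : ∀ {u} → Reach G S u u
  step : ∀ {u v w} → Adj G u v → v ∈ S → Reach G S v w → Reach G S u w

Connected : ∀ {n} → Graph n → VSet n → Set
Connected G S = ∀ u v → u ∈ S → v ∈ S → Reach G S u v

module _ {n : ℕ} (X : Graph n) where

  IsModule : VSet n → VSet n → Set
  IsModule S M =
    M ⊆ S × (∃[ v ] v ∈ M) ×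
    (∀ x → x ∈ S → ¬ (x ∈ M) →
       (∀ m → m ∈ M → Adj X x m) ⊎ (∀ m → m ∈ M → ¬ Adj X x m))

  Singleton : VSet n → Set
  Singleton M = ∃[ u ] (u ∈ M × (∀ v → v ∈ M → v ≡ u))

  Trivial : VSet n → VSet n → Set
  Trivial S M = M ≐ S ⊎ Singleton M

  Prime : VSet n → Set
  Prime S = ∀ M → IsModule S M → Trivial S M

  Complete : VSet n → Set
  Complete S = ∀ u v → u ∈ S → v ∈ S → u ≢ v → Adj X u v

  Edgeless : VSet n → Set
  Edgeless S = ∀ u v → u ∈ S → v ∈ S → ¬ Adj X u v

  Degenerate : VSet n → Set
  Degenerate S = Complete S ⊎ Edgeless S

  MaxProperModule : VSet n → VSet n → Set
  MaxProperModule S M =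
    IsModule S M × ¬ (M ≐ S) ×
    (∀ M' → IsModule S M' → ¬ (M' ≐ S) → M ⊆ M' → M' ≐ M)

  IsComponents : Graph n → VSet n → (k : ℕ) → (Fin n → Fin k) → Set
  IsComponents G S k f =
    (∀ i → Connected G (part S f i)) ×
    (∀ u v → u ∈ S → v ∈ S → f u ≢ f v → ¬ Adj G u v)

  -- which partition the modular decomposition uses at a non-leaf step
  data DecompCase (S : VSet n) (k : ℕ) (f : Fin n → Fin k) : Set where
    maxmod : Connected X S → Connected (compl X) S →
             (∀ i → MaxProperModule S (part S f i)) → DecompCase S k f
    comps  : ¬ Connected X S → Connected (compl X) S →
             IsComponents X S k f → DecompCase S k f
    cocomps : Connected X S → ¬ Connected (compl X) S →
             IsComponents (compl X) S k f → DecompCase S k f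

  -- A modular decomposition of X[S]; the modular tree is read off it.
  data MT (S : VSet n) : Set where
    leaf : Prime S ⊎ Degenerate S → MT S
    node : ¬ (Prime S ⊎ Degenerate S) →
           (k : ℕ) (f : Fin n → Fin k) →
           (∀ i → ∃[ v ] v ∈ part S f i) →
           DecompCase S k f →
           ((i : Fin k) → MT (part S f i)) → MT S

  -- vertices of the modular tree T
  -- leaf: the vertices of X[S];
  -- node: the marker vertices m_i of the root (inj₁ i), and for each i
  --       the new marker m_i' (inj₂ (i , nothing)) and the vertices of T_i.
  Point : ∀ {S} → MT S → Set
  Point {S} (leaf _) = Σ (Fin n) (λ v → v ∈ S)
  Point (node _ k _ _ _ ts) = Fin k ⊎ Σ (Fin k) (λ i → Maybe (Point (ts i)))

  IsNormal : ∀ {S} (t : MT S) → Point t → Set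
  IsNormal (leaf _) _ = ⊤
  IsNormal (node _ _ _ _ _ ts) (inj₁ _) = ⊥
  IsNormal (node _ _ _ _ _ ts) (inj₂ (_ , nothing)) = ⊥
  IsNormal (node _ _ _ _ _ ts) (inj₂ (i , just p)) = IsNormal (ts i) p

  IsMarker : ∀ {S} (t : MT S) → Point t → Set
  IsMarker t p = ¬ IsNormal t p

  IsRoot : ∀ {S} (t : MT S) → Point t → Set
  IsRoot (leaf _) _ = ⊤
  IsRoot (node _ _ _ _ _ _) (inj₁ _) = ⊤
  IsRoot (node _ _ _ _ _ _) (inj₂ _) = ⊥

  -- the normal vertex of T corresponding to a vertex v of X[S]
  emb : ∀ {S} (t : MT S) (v : Fin n) → v ∈ S → Point t
  emb (leaf _) v h = v , h
  emb {S} (node _ k f _ _ ts) v h = inj₂ (f v , just (emb (ts (f v)) v (in-own-part S f v h)))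

  NE : ∀ {S} (t : MT S) → Point t → Point t → Set
  NE (leaf _) (u , _) (v , _) = Adj X u v
  NE {S} (node _ k f _ _ ts) (inj₁ i) (inj₁ j) =
    i ≢ j × (∀ u v → u ∈ part S f i → v ∈ part S f j → Adj X u v)
  NE (node _ k f _ _ ts) (inj₁ _) (inj₂ _) = ⊥
  NE (node _ k f _ _ ts) (inj₂ _) (inj₁ _) = ⊥
  NE (node _ k f _ _ ts) (inj₂ (i , nothing)) (inj₂ (j , nothing)) = ⊥
  NE (node _ k f _ _ ts) (inj₂ (i , nothing)) (inj₂ (j , just q)) = i ≡ j × IsRoot (ts j) q
  NE (node _ k f _ _ ts) (inj₂ (i , just p)) (inj₂ (j , nothing)) = i ≡ j × IsRoot (ts i) p
  NE (node _ k f _ _ ts) (inj₂ (i , just p)) (inj₂ (j , just q)) =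
    Σ (i ≡ j) (λ { refl → NE (ts i) p q })

  -- directed tree edges of T (from m_i to m_i')
  TE : ∀ {S} (t : MT S) → Point t → Point t → Set
  TE (leaf _) _ _ = ⊥
  TE (node _ k f _ _ ts) (inj₁ i) (inj₂ (j , nothing)) = i ≡ j
  TE (node _ k f _ _ ts) (inj₁ _) (inj₂ (_ , just _)) = ⊥
  TE (node _ k f _ _ ts) (inj₁ _) (inj₁ _) = ⊥
  TE (node _ k f _ _ ts) (inj₂ _) (inj₁ _) = ⊥
  TE (node _ k f _ _ ts) (inj₂ (_ , nothing)) (inj₂ _) = ⊥
  TE (node _ k f _ _ ts) (inj₂ (_ , just _)) (inj₂ (_ , nothing)) = ⊥
  TE (node _ k f _ _ ts) (inj₂ (i , just p)) (inj₂ (j , just q)) =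
    Σ (i ≡ j) (λ { refl → TE (ts i) p q })

  TEu : ∀ {S} (t : MT S) → Point t → Point t → Set
  TEu t p q = TE t p q ⊎ TE t q p

  Alt : ∀ {S} (t : MT S) → Point t → List (Point t) → Point t → Set
  Alt t x [] y = NE t x y
  Alt t x (a ∷ []) y = ⊥
  Alt t x (a ∷ b ∷ ms) y = NE t x a × TEu t a b × Alt t b ms y

  AltPath : ∀ {S} (t : MT S) → Point t → Point t → Set
  AltPath t x y =
    Σ (List (Point t)) λ ms →
      All (IsMarker t) ms × Unique (x ∷ ms ++ [ y ]) × Alt t x ms y

module Submission where

-- Every vertex p of T represents a set Rep p of vertices of X: a normal
-- vertex represents itself, and the two markers m_i (in a quotient node)
-- and m_i' (joined to the root node of T_i) created for a block M_i both
-- represent M_i.  Three local facts drive the proof: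
--   * a tree edge m_i m_i' keeps the represented set;
--   * a normal edge at m_i' enters the root node of T_i, so its other
--     end represents a subset of M_i;
--   * any other normal edge joins two sets completely adjacent in X.
-- Path ⇒ edge: walking from x we first stay on sets containing x, cross
-- exactly one joining edge, and then descend through sets all adjacent to
-- x; the walk ends at y, so xy is an edge.
-- Edge ⇒ path: by induction on T.  If x, y lie in one block we lift the
-- path of the subtree.  Otherwise we climb from x to the quotient marker
-- m_{f x}, cross the quotient edge m_{f x} m_{f y} (two blocks of the
-- decomposition sharing an edge are completely joined) and descend to y.

open import Defs
open import Data.Nat using (ℕ)
open import Data.Fin using (Fin; _≟_)
open import Data.Bool using (Bool; true; false)
import Data.Bool as Bool using (_≟_)
open import Data.Product using (∃-syntax; _×_; _,_; proj₁; proj₂)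
open import Data.Sum using (_⊎_; inj₁; inj₂)
open import Data.Maybe using (just; nothing)
open import Data.Empty using (⊥; ⊥-elim)
open import Data.Unit using (tt)
open import Data.List using (List; []; _∷_; _++_; [_]; map)
open import Data.List.Properties using (map-++; ++-assoc)
open import Data.List.Relation.Unary.All as All using (All; []; _∷_)
import Data.List.Relation.Unary.All.Properties as AllP
open import Data.List.Relation.Unary.AllPairs using ([]; _∷_)
open import Data.List.Relation.Unary.Unique.Propositional using (Unique)
import Data.List.Relation.Unary.Unique.Propositional.Properties as UniqueP
open import Data.List.Relation.Binary.Disjoint.Propositional using (Disjoint)
import Data.List.Membership.Propositional.Properties as Membership
open import Relation.Nullary using (¬_; yes; no)
open import Relation.Binary.PropositionalEquality
  using (_≡_; _≢_; refl; sym; trans; cong; subst)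
open import Function.Bundles using (_⇔_; mk⇔)
open import Function.Definitions using (Injective)
import Axiom.UniquenessOfIdentityProofs as UIP

-- Membership proofs v ∈ S are proofs of S v ≡ true, hence all equal.
membership-irrelevant : ∀ {b : Bool} (p q : b ≡ true) → p ≡ q
membership-irrelevant = UIP.Decidable⇒UIP.≡-irrelevant Bool._≟_

separated : ∀ {A I : Set} (g : A → I) {i j xs ys} →
            All (λ p → g p ≡ i) xs → All (λ p → g p ≡ j) ys → i ≢ j →
            Disjoint xs ys
separated g gxs gys i≢j (p∈xs , p∈ys) =
  i≢j (trans (sym (All.lookup gxs p∈xs)) (All.lookup gys p∈ys))

image-disjoint : ∀ {A B : Set} (g : A → B) {xs ys} →
                 All (λ w → ∀ a → g a ≢ w) ys → Disjoint (map g xs) ys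
image-disjoint g fresh (w∈image , w∈ys) with Membership.∈-map⁻ g w∈image
... | a , _ , w≡ga = All.lookup fresh w∈ys a (sym w≡ga)

unique-image-++ : ∀ {A B : Set} {g : A → B} {xs ys} → Injective _≡_ _≡_ g →
                  Unique xs → Unique ys → All (λ w → ∀ a → g a ≢ w) ys →
                  Unique (map g xs ++ ys)
unique-image-++ {g = g} g-inj uxs uys fresh =
  UniqueP.++⁺ (UniqueP.map⁺ g-inj uxs) uys (image-disjoint g fresh)

unique-++-image : ∀ {A B : Set} {g : A → B} {xs ys} → Injective _≡_ _≡_ g →
                  Unique ys → Unique xs → All (λ w → ∀ a → g a ≢ w) ys →
                  Unique (ys ++ map g xs)
unique-++-image {g = g} g-inj uys uxs fresh =
  UniqueP.++⁺ uys (UniqueP.map⁺ g-inj uxs)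
    (λ (w∈ys , w∈image) → image-disjoint g fresh (w∈image , w∈ys))

-- Throughout, the graph X is fixed and t ranges over the modular trees
-- MT X S of its induced subgraphs X[S]; the statements are proved for
-- every S so that induction on the tree goes through.
module ModularTree {n : ℕ} (X : Graph n) where

  adj-symmetric : ∀ {u v} → Adj X u v → Adj X v u
  adj-symmetric {u} {v} uv = trans (adj-sym X v u) uv

  part⁻ : ∀ {k} S (f : Fin n → Fin k) {i v} → v ∈ part S f i → v ∈ S × f v ≡ i
  part⁻ S f {i} {v} h with S v | f v ≟ i
  part⁻ S f {i} {v} h  | true  | yes fv≡i = refl , fv≡i
  part⁻ S f {i} {v} () | true  | no _
  part⁻ S f {i} {v} () | false | _

  non-co-adjacent⇒adjacent : ∀ {u v} → u ≢ v → ¬ Adj (compl X) u v → Adj X u v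
  non-co-adjacent⇒adjacent {u} {v} u≢v h with u ≟ v | adj X u v
  ... | yes u≡v | _     = ⊥-elim (u≢v u≡v)
  ... | no _    | true  = refl
  ... | no _    | false = ⊥-elim (h refl)

  module-absorbs : ∀ {S M x m} → IsModule X S M → x ∈ S → ¬ x ∈ M →
                   m ∈ M → Adj X x m → ∀ {u} → u ∈ M → Adj X x u
  module-absorbs (_ , _ , homogeneous) x∈S x∉M m∈M xm u∈M
    with homogeneous _ x∈S x∉M
  ... | inj₁ sees-all  = sees-all _ u∈M
  ... | inj₂ sees-none = ⊥-elim (sees-none _ m∈M xm)

  -- Two blocks of the partition used by the decomposition that carry one
  -- edge are completely joined (this makes the quotient X/P well defined).
  blocks-joined : ∀ {S k f} → DecompCase X S k f →
                  ∀ {x y} → x ∈ S → y ∈ S → f x ≢ f y → Adj X x y →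
                  ∀ {u v} → u ∈ part S f (f x) → v ∈ part S f (f y) → Adj X u v
  blocks-joined {S} {f = f} (maxmod _ _ maximal) {x} {y} x∈S y∈S fx≢fy xy {u} {v} u∈Mx v∈My =
    module-absorbs (proj₁ (maximal (f y))) (proj₁ (part⁻ S f u∈Mx)) u∉My
      (in-own-part S f y y∈S) (adj-symmetric yu) v∈My
    where
    y∉Mx : ¬ y ∈ part S f (f x)
    y∉Mx y∈Mx = fx≢fy (sym (proj₂ (part⁻ S f y∈Mx)))
    yu : Adj X y u
    yu = module-absorbs (proj₁ (maximal (f x))) y∈S y∉Mx
           (in-own-part S f x x∈S) (adj-symmetric xy) u∈Mx
    u∉My : ¬ u ∈ part S f (f y)
    u∉My u∈My = fx≢fy (trans (sym (proj₂ (part⁻ S f u∈Mx))) (proj₂ (part⁻ S f u∈My)))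
  blocks-joined (comps _ _ (_ , no-edges)) x∈S y∈S fx≢fy xy _ _ =
    ⊥-elim (no-edges _ _ x∈S y∈S fx≢fy xy)
  blocks-joined {S} {f = f} (cocomps _ _ (_ , no-co-edges)) _ _ fx≢fy _ {u} {v} u∈Mx v∈My =
    non-co-adjacent⇒adjacent (λ u≡v → fu≢fv (cong f u≡v))
      (no-co-edges _ _ (proj₁ (part⁻ S f u∈Mx)) (proj₁ (part⁻ S f v∈My)) fu≢fv)
    where
    fu≢fv : f u ≢ f v
    fu≢fv fu≡fv = fx≢fy (trans (sym (proj₂ (part⁻ S f u∈Mx)))
                               (trans fu≡fv (proj₂ (part⁻ S f v∈My))))

  -- The three kinds of vertices of a modular tree: quotient markers m_i,
  -- link markers m_i' (the head of the tree edge m_i → m_i'), and normal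
  -- vertices (the vertices of X).
  data Kind : Set where
    quotient link normal : Kind

  quotient≢link : ∀ {κ} → κ ≡ quotient → κ ≢ link
  quotient≢link refl ()

  normal≢link : ∀ {κ} → κ ≡ normal → κ ≢ link
  normal≢link refl ()

  kind : ∀ {S} (t : MT X S) → Point X t → Kind
  kind (leaf _) _ = normal
  kind (node _ _ _ _ _ ts) (inj₁ _) = quotient
  kind (node _ _ _ _ _ ts) (inj₂ (_ , nothing)) = link
  kind (node _ _ _ _ _ ts) (inj₂ (i , just p)) = kind (ts i) p

  Rep : ∀ {S} (t : MT X S) → Point X t → Fin n → Set
  Rep (leaf _) (u , _) v = v ≡ u
  Rep {S} (node _ _ f _ _ ts) (inj₁ i) v = v ∈ part S f i
  Rep {S} (node _ _ f _ _ ts) (inj₂ (i , nothing)) v = v ∈ part S f i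
  Rep (node _ _ _ _ _ ts) (inj₂ (i , just p)) v = Rep (ts i) p v

  _⊑_ : (Fin n → Set) → (Fin n → Set) → Set
  A ⊑ B = ∀ {v} → A v → B v

  Joined : (Fin n → Set) → (Fin n → Set) → Set
  Joined A B = ∀ {u v} → A u → B v → Adj X u v

  Rep-within : ∀ {S} (t : MT X S) p → Rep t p ⊑ (_∈ S)
  Rep-within (leaf _) (u , u∈S) refl = u∈S
  Rep-within {S} (node _ _ f _ _ ts) (inj₁ i) v∈Mi = proj₁ (part⁻ S f v∈Mi)
  Rep-within {S} (node _ _ f _ _ ts) (inj₂ (i , nothing)) v∈Mi = proj₁ (part⁻ S f v∈Mi)
  Rep-within {S} (node _ _ f _ _ ts) (inj₂ (i , just p)) r =
    proj₁ (part⁻ S f (Rep-within (ts i) p r))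

  root-not-link : ∀ {S} (t : MT X S) p → IsRoot X t p → kind t p ≢ link
  root-not-link (leaf _) _ _ ()
  root-not-link (node _ _ _ _ _ _) (inj₁ _) _ ()
  root-not-link (node _ _ _ _ _ _) (inj₂ _) ()

  emb-shape : ∀ {S} (t : MT X S) v h → kind t (emb X t v h) ≡ normal × Rep t (emb X t v h) v
  emb-shape (leaf _) v h = refl , refl
  emb-shape {S} (node _ _ f _ _ ts) v h = emb-shape (ts (f v)) v (in-own-part S f v h)

  -- A tree edge runs from a quotient marker m_i to the link marker m_i';
  -- both represent M_i (only the inclusion needed below is recorded).
  tree-edge-shape : ∀ {S} (t : MT X S) p q → TE X t p q →
                    kind t p ≡ quotient × kind t q ≡ link × Rep t q ⊑ Rep t p
  tree-edge-shape (node _ _ _ _ _ ts) (inj₁ i) (inj₂ (.i , nothing)) refl = refl , refl , λ r → r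
  tree-edge-shape (node _ _ _ _ _ ts) (inj₂ (i , just p)) (inj₂ (.i , just q)) (refl , te) =
    tree-edge-shape (ts i) p q te

  normal-edge-from-link : ∀ {S} (t : MT X S) p q → NE X t p q → kind t p ≡ link →
                          Rep t q ⊑ Rep t p × kind t q ≢ link
  normal-edge-from-link (node _ _ _ _ _ ts) (inj₂ (i , nothing)) (inj₂ (.i , just q)) (refl , q-root) _ =
    Rep-within (ts i) q , root-not-link (ts i) q q-root
  normal-edge-from-link (node _ _ _ _ _ ts) (inj₂ (i , just p)) (inj₂ (.i , nothing)) (refl , p-root) p-link =
    ⊥-elim (root-not-link (ts i) p p-root p-link)
  normal-edge-from-link (node _ _ _ _ _ ts) (inj₂ (i , just p)) (inj₂ (.i , just q)) (refl , pq) p-link =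
    normal-edge-from-link (ts i) p q pq p-link

  normal-edge-from-other : ∀ {S} (t : MT X S) p q → NE X t p q → kind t p ≢ link →
                           (kind t q ≡ link × Rep t p ⊑ Rep t q) ⊎
                           (kind t q ≢ link × Joined (Rep t p) (Rep t q))
  normal-edge-from-other (leaf _) (u , _) (v , _) uv _ = inj₂ ((λ ()) , λ { refl refl → uv })
  normal-edge-from-other (node _ _ _ _ _ ts) (inj₁ i) (inj₁ j) (_ , joined) _ =
    inj₂ ((λ ()) , joined _ _)
  normal-edge-from-other (node _ _ _ _ _ ts) (inj₂ (i , nothing)) _ _ p-not-link =
    ⊥-elim (p-not-link refl)
  normal-edge-from-other (node _ _ _ _ _ ts) (inj₂ (i , just p)) (inj₂ (.i , nothing)) (refl , _) _ =
    inj₁ (refl , Rep-within (ts i) p)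
  normal-edge-from-other (node _ _ _ _ _ ts) (inj₂ (i , just p)) (inj₂ (.i , just q)) (refl , pq) p-not-link =
    normal-edge-from-other (ts i) p q pq p-not-link

  tree-edge-down : ∀ {S} (t : MT X S) a c → TEu X t a c → kind t a ≢ link → TE X t a c
  tree-edge-down t a c (inj₁ ac) _ = ac
  tree-edge-down t a c (inj₂ ca) a-not-link =
    ⊥-elim (a-not-link (proj₁ (proj₂ (tree-edge-shape t c a ca))))

  tree-edge-up : ∀ {S} (t : MT X S) a c → TEu X t a c → kind t a ≡ link → TE X t c a
  tree-edge-up t a c (inj₁ ac) a-link = ⊥-elim (quotient≢link (proj₁ (tree-edge-shape t a c ac)) a-link)
  tree-edge-up t a c (inj₂ ca) _ = ca

  module Walk (x y : Fin n) where

    -- Descending phase: at a link marker whose whole set is adjacent to x.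
    descend : ∀ {S} (t : MT X S) b ms q → kind t b ≡ link → (∀ {v} → Rep t b v → Adj X x v) →
              Alt X t b ms q → Rep t q y → Adj X x y
    descend t b [] q b-link near bq y∈q = near (proj₁ (normal-edge-from-link t b q bq b-link) y∈q)
    descend t b (a ∷ c ∷ ms) q b-link near (ba , ac , path) y∈q =
      let (a⊑b , a-not-link) = normal-edge-from-link t b a ba b-link
          (_ , c-link , c⊑a) = tree-edge-shape t a c (tree-edge-down t a c ac a-not-link)
      in descend t c ms q c-link (λ r → near (a⊑b (c⊑a r))) path y∈q

    -- Ascending phase: at a non-link vertex whose set contains x.
    ascend : ∀ {S} (t : MT X S) p ms q → kind t p ≢ link → Rep t p x →
             Alt X t p ms q → Rep t q y → kind t q ≢ link → Adj X x y
    ascend t p [] q p-not-link x∈p pq y∈q q-not-link with normal-edge-from-other t p q pq p-not-link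
    ... | inj₁ (q-link , _) = ⊥-elim (q-not-link q-link)
    ... | inj₂ (_ , joined) = joined x∈p y∈q
    ascend t p (a ∷ c ∷ ms) q p-not-link x∈p (pa , ac , path) y∈q q-not-link
      with normal-edge-from-other t p a pa p-not-link
    ... | inj₁ (a-link , p⊑a) =
      let (c-quotient , _ , a⊑c) = tree-edge-shape t c a (tree-edge-up t a c ac a-link)
      in ascend t c ms q (quotient≢link c-quotient) (a⊑c (p⊑a x∈p)) path y∈q q-not-link
    ... | inj₂ (a-not-link , joined) =
      let (_ , c-link , c⊑a) = tree-edge-shape t a c (tree-edge-down t a c ac a-not-link)
      in descend t c ms q c-link (λ r → joined x∈p (c⊑a r)) path y∈q

  path⇒edge : ∀ {S} (t : MT X S) x y hx hy →
              AltPath X t (emb X t x hx) (emb X t y hy) → Adj X x y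
  path⇒edge t x y hx hy (ms , _ , _ , path) =
    let (x-normal , x∈x) = emb-shape t x hx
        (y-normal , y∈y) = emb-shape t y hy
    in Walk.ascend x y t _ ms _ (normal≢link x-normal) x∈x path y∈y (normal≢link y-normal)

  Segment : ∀ {S} (t : MT X S) → Point X t → List (Point X t) → Point X t → Set
  Segment t x [] r = x ≡ r
  Segment t x (a ∷ []) r = ⊥
  Segment t x (a ∷ b ∷ ms) r = NE X t x a × TEu X t a b × Segment t b ms r

  -- An alternating path a₁ b₁ … ending at y that starts in the root node of
  -- T with the tree edge a₁ b₁; it is what follows a normal edge into the
  -- root of a subtree.
  FromRoot : ∀ {S} (t : MT X S) → List (Point X t) → Point X t → Set
  FromRoot t [] y = IsRoot X t y
  FromRoot t (a ∷ []) y = ⊥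
  FromRoot t (a ∷ b ∷ ms) y = IsRoot X t a × TEu X t a b × Alt X t b ms y

  segment-++-path : ∀ {S} (t : MT X S) x ms r ms' y →
                    Segment t x ms r → Alt X t r ms' y → Alt X t x (ms ++ ms') y
  segment-++-path t x [] r ms' y refl path = path
  segment-++-path t x (a ∷ b ∷ ms) r ms' y (xa , ab , seg) path =
    xa , ab , segment-++-path t b ms r ms' y seg path

  segment-++ : ∀ {S} (t : MT X S) x ms r ms' y →
               Segment t x ms r → Segment t r ms' y → Segment t x (ms ++ ms') y
  segment-++ t x [] r ms' y refl seg' = seg'
  segment-++ t x (a ∷ b ∷ ms) r ms' y (xa , ab , seg) seg' =
    xa , ab , segment-++ t b ms r ms' y seg seg'

  module Node {S} (np : ¬ (Prime X S ⊎ Degenerate X S)) (k : ℕ) (f : Fin n → Fin k)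
              (ex : ∀ i → ∃[ v ] v ∈ part S f i) (dc : DecompCase X S k f)
              (ts : (i : Fin k) → MT X (part S f i)) where

    t : MT X S
    t = node np k f ex dc ts

    lift : (i : Fin k) → Point X (ts i) → Point X t
    lift i p = inj₂ (i , just p)

    branch : Point X t → Fin k
    branch (inj₁ i) = i
    branch (inj₂ (i , _)) = i

    lift-injective : ∀ {i} → Injective _≡_ _≡_ (lift i)
    lift-injective refl = refl

    lifted-in-branch : ∀ i ps → All (λ p → branch p ≡ i) (map (lift i) ps)
    lifted-in-branch i ps = AllP.map⁺ (All.universal (λ _ → refl) ps)

    lift-tree-edge : ∀ {i} a b → TEu X (ts i) a b → TEu X t (lift i a) (lift i b)
    lift-tree-edge a b (inj₁ ab) = inj₁ (refl , ab)
    lift-tree-edge a b (inj₂ ba) = inj₂ (refl , ba)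

    lift-path : ∀ {i} p ms q → Alt X (ts i) p ms q → Alt X t (lift i p) (map (lift i) ms) (lift i q)
    lift-path p [] q pq = refl , pq
    lift-path p (a ∷ b ∷ ms) q (pa , ab , path) =
      (refl , pa) , lift-tree-edge a b ab , lift-path b ms q path

    lift-segment : ∀ {i} p ms q → Segment (ts i) p ms q →
                   Segment t (lift i p) (map (lift i) ms) (lift i q)
    lift-segment p [] q refl = refl
    lift-segment p (a ∷ b ∷ ms) q (pa , ab , seg) =
      (refl , pa) , lift-tree-edge a b ab , lift-segment b ms q seg

    -- m_i' is joined to the whole root node of T_i.
    lift-from-root : ∀ {i} ms q → FromRoot (ts i) ms q →
                     Alt X t (inj₂ (i , nothing)) (map (lift i) ms) (lift i q)
    lift-from-root [] q q-root = refl , q-root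
    lift-from-root (a ∷ b ∷ ms) q (a-root , ab , path) =
      (refl , a-root) , lift-tree-edge a b ab , lift-path b ms q path

    lift-alt-path : ∀ {i} p q → AltPath X (ts i) p q → AltPath X t (lift i p) (lift i q)
    lift-alt-path {i} p q (ms , markers , unique , path) =
      map (lift i) ms ,
      AllP.map⁺ markers ,
      subst (λ zs → Unique (lift i p ∷ zs)) (map-++ (lift i) ms [ q ])
        (UniqueP.map⁺ lift-injective unique) ,
      lift-path p ms q path

    emb-in-block : ∀ {v i} (hv : v ∈ S) → f v ≡ i → (h : v ∈ part S f i) →
                   emb X t v hv ≡ lift i (emb X (ts i) v h)
    emb-in-block {v} hv refl h =
      cong (λ h' → lift (f v) (emb X (ts (f v)) v h'))
        (membership-irrelevant (in-own-part S f v hv) h)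

  top : ∀ {S} (t : MT X S) v → v ∈ S → Point X t
  top (leaf _) v h = v , h
  top (node _ _ f _ _ _) v h = inj₁ (f v)

  top-root : ∀ {S} (t : MT X S) v h → IsRoot X t (top t v h)
  top-root (leaf _) v h = tt
  top-root (node _ _ _ _ _ _) v h = tt

  climb : ∀ {S} (t : MT X S) v → v ∈ S → List (Point X t)
  climb (leaf _) v h = []
  climb {S} (node np k f ex dc ts) v h =
    map (lift (f v)) (climb (ts (f v)) v (in-own-part S f v h)) ++ inj₂ (f v , nothing) ∷ inj₁ (f v) ∷ []
    where open Node np k f ex dc ts

  descent : ∀ {S} (t : MT X S) v → v ∈ S → List (Point X t)
  descent (leaf _) v h = []
  descent {S} (node np k f ex dc ts) v h =
    inj₁ (f v) ∷ inj₂ (f v , nothing) ∷ map (lift (f v)) (descent (ts (f v)) v (in-own-part S f v h))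
    where open Node np k f ex dc ts

  climb-segment : ∀ {S} (t : MT X S) v h → Segment t (emb X t v h) (climb t v h) (top t v h)
  climb-segment (leaf _) v h = refl
  climb-segment {S} (node np k f ex dc ts) v h =
    segment-++ t _ (map (lift (f v)) (climb (ts (f v)) v h')) (lift (f v) (top (ts (f v)) v h')) _ _
      (lift-segment _ _ _ (climb-segment (ts (f v)) v h'))
      ((refl , top-root (ts (f v)) v h') , inj₂ refl , refl)
    where
    open Node np k f ex dc ts
    h' : v ∈ part S f (f v)
    h' = in-own-part S f v h

  climb-markers : ∀ {S} (t : MT X S) v h → All (IsMarker X t) (climb t v h)
  climb-markers (leaf _) v h = []
  climb-markers {S} (node np k f ex dc ts) v h =
    AllP.++⁺ (AllP.map⁺ (climb-markers (ts (f v)) v (in-own-part S f v h))) ((λ ()) ∷ (λ ()) ∷ [])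

  climb-unique : ∀ {S} (t : MT X S) v h → Unique (emb X t v h ∷ climb t v h)
  climb-unique (leaf _) v h = [] ∷ []
  climb-unique {S} (node np k f ex dc ts) v h =
    unique-image-++ lift-injective (climb-unique (ts (f v)) v (in-own-part S f v h))
      (((λ ()) ∷ []) ∷ [] ∷ []) ((λ _ ()) ∷ (λ _ ()) ∷ [])
    where open Node np k f ex dc ts

  descent-from-root : ∀ {S} (t : MT X S) v h → FromRoot t (descent t v h) (emb X t v h)
  descent-from-root (leaf _) v h = tt
  descent-from-root {S} (node np k f ex dc ts) v h =
    tt , inj₁ refl , lift-from-root (descent (ts (f v)) v h') (emb X (ts (f v)) v h')
                       (descent-from-root (ts (f v)) v h')
    where
    open Node np k f ex dc ts
    h' : v ∈ part S f (f v)
    h' = in-own-part S f v h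

  descent-markers : ∀ {S} (t : MT X S) v h → All (IsMarker X t) (descent t v h)
  descent-markers (leaf _) v h = []
  descent-markers {S} (node np k f ex dc ts) v h =
    (λ ()) ∷ (λ ()) ∷ AllP.map⁺ (descent-markers (ts (f v)) v (in-own-part S f v h))

  descent-unique : ∀ {S} (t : MT X S) v h → Unique (descent t v h ++ [ emb X t v h ])
  descent-unique (leaf _) v h = [] ∷ []
  descent-unique {S} (node np k f ex dc ts) v h =
    subst (λ zs → Unique (inj₁ (f v) ∷ inj₂ (f v , nothing) ∷ zs))
      (map-++ (lift (f v)) (descent (ts (f v)) v h') [ emb X (ts (f v)) v h' ])
      (unique-++-image lift-injective (((λ ()) ∷ []) ∷ [] ∷ [])
        (descent-unique (ts (f v)) v h') ((λ _ ()) ∷ (λ _ ()) ∷ []))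
    where
    open Node np k f ex dc ts
    h' : v ∈ part S f (f v)
    h' = in-own-part S f v h

  path-across-blocks : ∀ {S} np k f ex dc (ts : (i : Fin k) → MT X (part S f i)) {x y} hx hy →
                       f x ≢ f y → Adj X x y →
                       let t = node np k f ex dc ts in AltPath X t (emb X t x hx) (emb X t y hy)
  path-across-blocks {S} np k f ex dc ts {x} {y} hx hy fx≢fy xy =
    climb t x hx ++ descent t y hy ,
    AllP.++⁺ (climb-markers t x hx) (descent-markers t y hy) ,
    subst (λ zs → Unique (emb X t x hx ∷ zs))
      (sym (++-assoc (climb t x hx) (descent t y hy) [ emb X t y hy ]))
      (UniqueP.++⁺ (climb-unique t x hx) (descent-unique t y hy)
        (separated branch climb-in-branch descent-in-branch fx≢fy)) ,
    segment-++-path t _ (climb t x hx) _ (descent t y hy) _ (climb-segment t x hx) crossing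
    where
    open Node np k f ex dc ts
    hx' : x ∈ part S f (f x)
    hx' = in-own-part S f x hx
    climb-in-branch : All (λ p → branch p ≡ f x) (emb X t x hx ∷ climb t x hx)
    climb-in-branch =
      AllP.++⁺ (lifted-in-branch (f x) (emb X (ts (f x)) x hx' ∷ climb (ts (f x)) x hx')) (refl ∷ refl ∷ [])
    descent-in-branch : All (λ p → branch p ≡ f y) (descent t y hy ++ [ emb X t y hy ])
    descent-in-branch =
      refl ∷ refl ∷ AllP.++⁺ (lifted-in-branch (f y) (descent (ts (f y)) y (in-own-part S f y hy))) (refl ∷ [])
    crossing : Alt X t (inj₁ (f x)) (descent t y hy) (emb X t y hy)
    crossing =
      let (_ , down , rest) = descent-from-root t y hy
      in (fx≢fy , λ _ _ → blocks-joined dc hx hy fx≢fy xy) , down , rest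

  edge⇒path : ∀ {S} (t : MT X S) x y hx hy → x ≢ y → Adj X x y →
              AltPath X t (emb X t x hx) (emb X t y hy)
  edge⇒path (leaf _) x y hx hy x≢y xy =
    [] , [] , ((λ e → x≢y (cong proj₁ e)) ∷ []) ∷ [] ∷ [] , xy
  edge⇒path {S} (node np k f ex dc ts) x y hx hy x≢y xy with f x ≟ f y
  ... | no fx≢fy = path-across-blocks np k f ex dc ts hx hy fx≢fy xy
  ... | yes fx≡fy =
    subst (AltPath X t (emb X t x hx)) (sym (emb-in-block hy (sym fx≡fy) hy'))
      (lift-alt-path _ _ (edge⇒path (ts (f x)) x y (in-own-part S f x hx) hy' x≢y xy))
    where
    open Node np k f ex dc ts
    hy' : y ∈ part S f (f x)
    hy' = subst (λ i → y ∈ part S f i) (sym fx≡fy) (in-own-part S f y hy)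

mainTheorem1 : (n : ℕ) (X : Graph n) (T : MT X full) (x y : Fin n) → x ≢ y →
    Adj X x y ⇔ AltPath X T (emb X T x refl) (emb X T y refl)
mainTheorem1 n X T x y x≢y =
  mk⇔ (edge⇒path T x y refl refl x≢y) (path⇒edge T x y refl refl)
  where open ModularTree X
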